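{- Let $F\colon\mathsf{Set}\to\mathsf{Set}$ be a functor and $\Lambda$ a set of unary modalities interpreted by monotone natural predicate liftings. Let $V,V'$ be finite sets, $\gamma\subseteq\Lambda(V)$, $\Theta\subseteq\mathcal P(V)$, $\Theta'\subseteq\mathcal P(V')$, and $g\colon V\to V'$, and put $\gamma_g=\{\heartsuit g(a)\mid\heartsuit a\in\gamma\}$. Suppose that for each $u\in\Theta$ there exists $u'\in\Theta'$ with $g[u]\subseteq u'$. If the one-step pair $(\gamma,\Theta)$ is satisfiable, then so is $(\gamma_g,\Theta')$.
   Context: For a set $Z$, $\Lambda(Z)=\{\heartsuit z\mid\heartsuit\in\Lambda,z\in Z\}$ (modal literals). For a finite set $V$ and $\Theta\subseteq\mathcal P(V)$, define $[\![a]\!]^\Theta_0=\{u\in\Theta\mid a\in u\}$ for $a\in V$ and, for $\gamma\subseteq\Lambda(V)$, $[\![\gamma]\!]^\Theta_1=\bigcap_{\heartsuit a\in\gamma}[\![\heartsuit]\!]_\Theta([\![a]\!]^\Theta_0)\subseteq F\Theta$. The pair $(\gamma,\Theta)$ (a one-step pair over $V$) is satisfiable if $[\![\gamma]\!]^\Theta_1\neq\emptyset$. Predicate liftings $[\![\heartsuit]\!]_U\colon\mathcal P U\to\mathcal P(FU)$ are monotone and natural: $[\![\heartsuit]\!]_U(f^{ -1}[Z])=(Ff)^{ -1}[[\![\heartsuit]\!]_W(Z)]$ for $f\colon U\to W$. -}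

module Defs where

open import Level using (Level; 0ℓ) renaming (suc to lsuc)
open import Data.Nat using (ℕ)
open import Data.Fin using (Fin)
open import Data.Fin.Subset using (Subset; _∈_)
open import Data.Bool using (Bool; T)
open import Data.Product using (Σ; Σ-syntax; _×_; _,_; proj₁)
open import Relation.Binary.PropositionalEquality using (_≡_)
open import Function using (id; _∘_)

-- A functor F : Set → Set (object part, morphism part, functor laws,
-- stated pointwise since function extensionality is not available).
record SetFunctor : Set₁ where
  field
    F       : Set → Set
    fmap    : {A B : Set} → (A → B) → F A → F B
    fmap-id : {A : Set} (t : F A) → fmap id t ≡ t
    fmap-∘  : {A B C : Set} (f : A → B) (g : B → C) (t : F A) →
              fmap (g ∘ f) t ≡ fmap g (fmap f t)

Pred : Set → Set₁
Pred U = U → Set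

record Liftings (Fn : SetFunctor) (Λ : Set) : Set₁ where
  open SetFunctor Fn
  field
    ⟦_⟧ : Λ → (U : Set) → Pred U → Pred (F U)
    monotone : (♥ : Λ) (U : Set) (P Q : Pred U) →
               (∀ x → P x → Q x) → ∀ t → ⟦ ♥ ⟧ U P t → ⟦ ♥ ⟧ U Q t
    -- naturality: [[♥]]_U (f⁻¹[Z]) = (Ff)⁻¹[[[♥]]_W Z]  (as mutual inclusion)
    natural→ : (♥ : Λ) (U W : Set) (f : U → W) (Z : Pred W) (t : F U) →
               ⟦ ♥ ⟧ U (Z ∘ f) t → ⟦ ♥ ⟧ W Z (fmap f t)
    natural← : (♥ : Λ) (U W : Set) (f : U → W) (Z : Pred W) (t : F U) →
               ⟦ ♥ ⟧ W Z (fmap f t) → ⟦ ♥ ⟧ U (Z ∘ f) t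

-- The finite set V is Fin n; P(V) is Subset n.
-- Θ ⊆ P(V) is given by its (Boolean) characteristic function.
Family : ℕ → Set
Family n = Subset n → Bool

Elems : {n : ℕ} → Family n → Set
Elems {n} Θ = Σ[ u ∈ Subset n ] T (Θ u)

Literals : Set → ℕ → Set₁
Literals Λ n = Pred (Λ × Fin n)

rename : {Λ : Set} {n m : ℕ} → (Fin n → Fin m) → Literals Λ n → Literals Λ m
rename {Λ} {n} g γ (♥ , b) = Σ[ a ∈ Fin n ] (γ (♥ , a) × g a ≡ b)

module Semantics {Fn : SetFunctor} {Λ : Set} (L : Liftings Fn Λ) where
  open SetFunctor Fn
  open Liftings L

  ⟦_⟧₀ : {n : ℕ} → Fin n → (Θ : Family n) → Pred (Elems Θ)
  ⟦ a ⟧₀ Θ x = a ∈ proj₁ x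

  ⟦_⟧₁ : {n : ℕ} → Literals Λ n → (Θ : Family n) → Pred (F (Elems Θ))
  ⟦ γ ⟧₁ Θ t = ∀ ♥ a → γ (♥ , a) → ⟦ ♥ ⟧ (Elems Θ) (⟦ a ⟧₀ Θ) t

  Satisfiable : {n : ℕ} → Literals Λ n → Family n → Set
  Satisfiable γ Θ = Σ[ t ∈ F (Elems Θ) ] ⟦ γ ⟧₁ Θ t

-- The hypothesis yields a map f : Θ → Θ' with g[u] ⊆ f(u). Pulling back
-- [[g a]]_0 along f contains [[a]]_0, so monotonicity and naturality of each
-- lifting send a witness t of [[γ]]_1 to the witness (F f) t of [[γ_g]]_1.
module Submission where

open import Defs
open import Data.Nat using (ℕ)
open import Data.Fin using (Fin)
open import Data.Fin.Subset using (Subset; _∈_)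
open import Data.Bool using (T)
open import Data.Product using (Σ-syntax; _×_; _,_; proj₁; proj₂)
open import Relation.Binary.PropositionalEquality using (refl)

module _ {Fn : SetFunctor} {Λ : Set} (L : Liftings Fn Λ) where
  open SetFunctor Fn
  open Liftings L
  open Semantics L

  Covers : {n m : ℕ} → (Fin n → Fin m) → Family n → Family m → Set
  Covers {n} {m} g Θ Θ' =
    ∀ (u : Subset n) → T (Θ u) →
    Σ[ u' ∈ Subset m ] (T (Θ' u') × (∀ (a : Fin n) → a ∈ u → g a ∈ u'))

  module _ {n m : ℕ} {g : Fin n → Fin m} {Θ : Family n} {Θ' : Family m}
           (cover : Covers g Θ Θ') where

    coverMap : Elems Θ → Elems Θ'
    coverMap (u , u∈Θ) = proj₁ (cover u u∈Θ) , proj₁ (proj₂ (cover u u∈Θ))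

    ⟦⟧₀-⊆-coverMap⁻¹ : ∀ a x → ⟦ a ⟧₀ Θ x → ⟦ g a ⟧₀ Θ' (coverMap x)
    ⟦⟧₀-⊆-coverMap⁻¹ a (u , u∈Θ) = proj₂ (proj₂ (cover u u∈Θ)) a

    ⟦⟧₁-rename : ∀ γ t → ⟦ γ ⟧₁ Θ t → ⟦ rename g γ ⟧₁ Θ' (fmap coverMap t)
    ⟦⟧₁-rename γ t t∈⟦γ⟧ ♥ _ (a , ♥a∈γ , refl) =
      natural→ ♥ (Elems Θ) (Elems Θ') coverMap (⟦ g a ⟧₀ Θ') t
        (monotone ♥ (Elems Θ) (⟦ a ⟧₀ Θ) _ (⟦⟧₀-⊆-coverMap⁻¹ a) t (t∈⟦γ⟧ ♥ a ♥a∈γ))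

    satisfiable-rename : ∀ γ → Satisfiable γ Θ → Satisfiable (rename g γ) Θ'
    satisfiable-rename γ (t , t∈⟦γ⟧) = fmap coverMap t , ⟦⟧₁-rename γ t t∈⟦γ⟧

lemma4p6 : (Fn : SetFunctor) (Λ : Set) (L : Liftings Fn Λ)
           (n m : ℕ) (γ : Literals Λ n) (Θ : Family n) (Θ' : Family m)
           (g : Fin n → Fin m) →
           (∀ (u : Subset n) → T (Θ u) →
             Σ[ u' ∈ Subset m ] (T (Θ' u') × (∀ (a : Fin n) → a ∈ u → g a ∈ u'))) →
           Semantics.Satisfiable L γ Θ →
           Semantics.Satisfiable L (rename g γ) Θ'
lemma4p6 Fn Λ L n m γ Θ Θ' g cover = satisfiable-rename L cover γ
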